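{- Let $G=(V,E)$ be a finite simple graph with $n=|V|$ vertices and let $a_i$ be the number of matchings of $G$ with $i$ edges. Then $$M(G,x,y)=\sum_{i=0}^{n}a_i x^{n-2i}y^i=\xi(G,x,0,y).$$ In particular, the matching generating polynomial $g(G,x)=\sum_i a_i x^i$ equals $\xi(G,1,0,x)$, and the matching defect polynomial $\mu(G,x)=\sum_i(-1)^i a_i x^{n-2i}$ equals $\xi(G,x,0,-1)$.
   Context: For $S\subseteq E$, $V(S)$ is the set of vertices covered by edges of $S$, $k(S)$ the number of connected components of the spanning subgraph $(V,S)$, and $k_{cov}(B)$ the number of connected components of $(V(B),B)$. Define $\xi(G,x,y,z)=\sum_{(A,B)} x^{k(A\cup B)-k_{cov}(B)} y^{|A|+|B|-k_{cov}(B)} z^{k_{cov}(B)}$, summing over pairs $A,B\subseteq E$ with $V(A)\cap V(B)=\emptyset$, with the convention $0^0=1$ when a variable is set to $0$. -}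

module Defs where

open import Level using (Level)
open import Data.Bool using (Bool; true; false; _∧_; _∨_; not; if_then_else_)
open import Data.Nat using (ℕ; zero; suc; _∸_; _<ᵇ_; _≤ᵇ_; _≡ᵇ_) renaming (_+_ to _+ℕ_; _*_ to _*ℕ_)
open import Data.Fin using (Fin; toℕ)
open import Data.Fin.Properties using () renaming (_≟_ to _≟ᶠ_)
open import Data.List using (List; []; _∷_; _++_; map; concatMap; length; upTo; allFin; foldr)
open import Data.Product using (_×_; _,_; proj₁; proj₂)
open import Relation.Nullary.Decidable using (⌊_⌋)
open import Relation.Binary.PropositionalEquality using (_≡_)
open import Algebra.Bundles using (CommutativeRing)

record Graph (n : ℕ) : Set where
  field
    adj    : Fin n → Fin n → Bool
    sym    : ∀ i j → adj i j ≡ adj j i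
    irrefl : ∀ i → adj i i ≡ false
open Graph public

anyB : {A : Set} → (A → Bool) → List A → Bool
anyB p []       = false
anyB p (x ∷ xs) = p x ∨ anyB p xs

allB : {A : Set} → (A → Bool) → List A → Bool
allB p []       = true
allB p (x ∷ xs) = p x ∧ allB p xs

countB : {A : Set} → (A → Bool) → List A → ℕ
countB p []       = 0
countB p (x ∷ xs) = (if p x then 1 else 0) +ℕ countB p xs

-- all sub-lists (= all subsets of a duplicate-free list)
subsets : {A : Set} → List A → List (List A)
subsets []       = [] ∷ []
subsets (a ∷ as) = subsets as ++ map (a ∷_) (subsets as)

Edge : ℕ → Set
Edge n = Fin n × Fin n

eqF : {n : ℕ} → Fin n → Fin n → Bool
eqF i j = ⌊ i ≟ᶠ j ⌋

-- the edge set E: each edge {i,j} listed once as (i , j) with i < j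
edges : {n : ℕ} → Graph n → List (Edge n)
edges {n} G = concatMap (λ i → concatMap (λ j →
  if (toℕ i <ᵇ toℕ j) ∧ adj G i j then (i , j) ∷ [] else []) (allFin n)) (allFin n)

incident : {n : ℕ} → Fin n → Edge n → Bool
incident v e = eqF v (proj₁ e) ∨ eqF v (proj₂ e)

covers : {n : ℕ} → List (Edge n) → Fin n → Bool
covers S v = anyB (incident v) S

adjIn : {n : ℕ} → List (Edge n) → Fin n → Fin n → Bool
adjIn S u v = anyB (λ e → (eqF u (proj₁ e) ∧ eqF v (proj₂ e)) ∨ (eqF u (proj₂ e) ∧ eqF v (proj₁ e))) S

reach : {n : ℕ} → List (Edge n) → ℕ → Fin n → Fin n → Bool
reach S zero    u v = eqF u v
reach {n} S (suc k) u v = reach S k u v ∨ anyB (λ w → reach S k u w ∧ adjIn S w v) (allFin n)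

connected : {n : ℕ} → List (Edge n) → Fin n → Fin n → Bool
connected {n} S u v = reach S n u v

isRep : {n : ℕ} → List (Edge n) → Fin n → Bool
isRep {n} S v = not (anyB (λ u → (toℕ u <ᵇ toℕ v) ∧ connected S u v) (allFin n))

kcomp : {n : ℕ} → List (Edge n) → ℕ
kcomp {n} S = countB (isRep S) (allFin n)

-- k_cov(B): number of connected components of (V(B),B)
kcov : {n : ℕ} → List (Edge n) → ℕ
kcov {n} B = countB (λ v → covers B v ∧ isRep B v) (allFin n)

disjointV : {n : ℕ} → List (Edge n) → List (Edge n) → Bool
disjointV {n} A B = allB (λ v → not (covers A v ∧ covers B v)) (allFin n)

isMatching : {n : ℕ} → List (Edge n) → Bool
isMatching {n} S = allB (λ v → countB (incident v) S ≤ᵇ 1) (allFin n)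

matchCount : {n : ℕ} → Graph n → ℕ → ℕ
matchCount G i = countB (λ S → isMatching S ∧ (length S ≡ᵇ i)) (subsets (edges G))

-- Polynomial identities are stated over an arbitrary commutative ring
-- (for all values of the variables), i.e. as identities in ℤ[x,y,z].
module Poly {c ℓ : Level} (R : CommutativeRing c ℓ) where
  open CommutativeRing R

  pow : Carrier → ℕ → Carrier
  pow x zero    = 1#
  pow x (suc k) = x * pow x k

  ι : ℕ → Carrier
  ι zero    = 0#
  ι (suc k) = 1# + ι k

  sumR : List Carrier → Carrier
  sumR = foldr _+_ 0#

  ξ : {n : ℕ} → Graph n → Carrier → Carrier → Carrier → Carrier
  ξ G x y z = sumR (concatMap (λ A → map (λ B →
      if disjointV A B
      then pow x (kcomp (A ++ B) ∸ kcov B) * pow y (length A +ℕ length B ∸ kcov B) * pow z (kcov B)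
      else 0#) (subsets (edges G))) (subsets (edges G)))

  M : {n : ℕ} → Graph n → Carrier → Carrier → Carrier
  M {n} G x y = sumR (map (λ i → ι (matchCount G i) * pow x (n ∸ 2 *ℕ i) * pow y i) (upTo (suc n)))

  g : {n : ℕ} → Graph n → Carrier → Carrier
  g {n} G x = sumR (map (λ i → ι (matchCount G i) * pow x i) (upTo (suc n)))

  μ : {n : ℕ} → Graph n → Carrier → Carrier
  μ {n} G x = sumR (map (λ i → pow (- 1#) i * ι (matchCount G i) * pow x (n ∸ 2 *ℕ i)) (upTo (suc n)))

module Submission where

-- At y = 0 a pair (A,B) contributes to ξ only if |A| + |B| = k_cov(B).  The
-- heart of the proof is the inequality k_cov(B) ≤ |B|, with equality exactly
-- for matchings, obtained by double counting.  Let ρ(v) = 1 if v is the least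
-- vertex of its component of (V,B), else 0, and deg(v) the degree in B; then
--   k_cov(B) = Σ_v [v covered]·ρ(v) ≤ Σ_v ρ(v)·deg(v) = Σ_{(a,b)∈B, a<b} ρ(a) ≤ |B|
-- (handshake identity; the larger endpoint b is never least).  A vertex of
-- degree ≥ 2 makes one of the two inequalities strict.  So only A = ∅ and
-- matchings B survive, and a matching has k_cov(B) = |B| and
-- k(B) − k_cov(B) = #uncovered vertices = n − 2|B|.  Grouping matchings by
-- size gives Σᵢ aᵢ x^(n−2i) yⁱ; g and μ are the specialisations (1,x), (x,−1).

open import Defs hiding (sym)
open import Algebra.Bundles using (CommutativeRing)
open import Data.Bool using (Bool; true; false; _∧_; _∨_; not; if_then_else_; T)
open import Data.Nat using (ℕ; zero; suc; _+_; _*_; _∸_; _≤_; _<_; z≤n; s≤s; _<ᵇ_; _≡ᵇ_; _≤ᵇ_; _≤?_)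
open import Data.Nat.Properties
open import Data.Fin as F using (Fin; toℕ)
open import Data.Fin.Properties using (toℕ-injective; toℕ<n)
open import Data.List using (List; []; _∷_; _++_; map; length; tabulate; allFin; concatMap; applyUpTo; upTo)
open import Data.List.Relation.Unary.All as All using (All; []; _∷_)
import Data.List.Relation.Unary.All.Properties as AllP
open import Data.List.Relation.Unary.Any using (here; there)
open import Data.List.Membership.Propositional using (_∈_)
open import Data.List.Membership.Propositional.Properties using (∈-allFin)
import Data.List.Properties as ListP
open import Data.Product using (_×_; _,_; proj₁; proj₂; Σ)
open import Data.Sum using (_⊎_; inj₁; inj₂; swap)
open import Data.Empty using (⊥; ⊥-elim)
open import Relation.Binary using (tri<; tri≈; tri>)
open import Relation.Binary.PropositionalEquality
  using (_≡_; _≢_; refl; sym; trans; cong; cong₂; subst; module ≡-Reasoning)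
open import Relation.Nullary using (yes; no)
open import Algebra.Properties.CommutativeMonoid.Sum +-0-commutativeMonoid
  using (sum; ∑-distrib-+; sum-cong-≗; sum-replicate-zero)

true-false-clash : ∀ {b} → b ≡ true → b ≡ false → ⊥
true-false-clash refl ()

if-true : ∀ {a} {A : Set a} {b : Bool} {p q : A} → b ≡ true → (if b then p else q) ≡ p
if-true refl = refl

χ : Bool → ℕ
χ b = if b then 1 else 0

χ≤1 : ∀ b → χ b ≤ 1
χ≤1 true  = s≤s z≤n
χ≤1 false = z≤n

χ-∨ : ∀ x y → (x ≡ true → y ≡ false) → χ (x ∨ y) ≡ χ x + χ y
χ-∨ true  true  h = ⊥-elim (true-false-clash refl (h refl))
χ-∨ true  false h = refl
χ-∨ false y     h = refl

T⇒≡true : ∀ {b} → T b → b ≡ true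
T⇒≡true {true} _ = refl

≡true⇒T : ∀ {b} → b ≡ true → T b
≡true⇒T refl = _

∨-introˡ : ∀ {a} b → a ≡ true → (a ∨ b) ≡ true
∨-introˡ b refl = refl

∨-introʳ : ∀ a {b} → b ≡ true → (a ∨ b) ≡ true
∨-introʳ true  refl = refl
∨-introʳ false refl = refl

∨-elim : ∀ a b → (a ∨ b) ≡ true → a ≡ true ⊎ b ≡ true
∨-elim true  b _ = inj₁ refl
∨-elim false b e = inj₂ e

∧-intro : ∀ {a b} → a ≡ true → b ≡ true → (a ∧ b) ≡ true
∧-intro refl refl = refl

∧-elim : ∀ a b → (a ∧ b) ≡ true → a ≡ true × b ≡ true
∧-elim true true _ = refl , refl

not-intro : ∀ b → (b ≡ true → ⊥) → not b ≡ true
not-intro true  f = ⊥-elim (f refl)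
not-intro false f = refl

eqF-refl : ∀ {n} (v : Fin n) → eqF v v ≡ true
eqF-refl v with v F.≟ v
... | yes _ = refl
... | no v≢v = ⊥-elim (v≢v refl)

eqF⇒≡ : ∀ {n} (u v : Fin n) → eqF u v ≡ true → u ≡ v
eqF⇒≡ u v e with u F.≟ v
... | yes u≡v = u≡v

eqF-≢ : ∀ {n} (u v : Fin n) → u ≢ v → eqF u v ≡ false
eqF-≢ u v u≢v with u F.≟ v
... | yes u≡v = ⊥-elim (u≢v u≡v)
... | no _    = refl

eqF-suc : ∀ {n} (u v : Fin n) → eqF (F.suc u) (F.suc v) ≡ eqF u v
eqF-suc u v with u F.≟ v
... | yes _ = refl
... | no _  = refl

anyB-intro : ∀ {A : Set} (p : A → Bool) {L x} → x ∈ L → p x ≡ true → anyB p L ≡ true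
anyB-intro p {x ∷ xs} (here refl) px = ∨-introˡ (anyB p xs) px
anyB-intro p {x ∷ xs} (there x∈) px = ∨-introʳ (p x) (anyB-intro p x∈ px)

anyB-elim : ∀ {A : Set} (p : A → Bool) L → anyB p L ≡ true → Σ A (λ x → x ∈ L × p x ≡ true)
anyB-elim p (x ∷ xs) e with ∨-elim (p x) (anyB p xs) e
... | inj₁ px = x , here refl , px
... | inj₂ rest with anyB-elim p xs rest
...   | y , y∈ , py = y , there y∈ , py

allB-intro : ∀ {A : Set} (p : A → Bool) L → (∀ x → p x ≡ true) → allB p L ≡ true
allB-intro p []       h = refl
allB-intro p (x ∷ xs) h rewrite h x = allB-intro p xs h

allB-elim : ∀ {A : Set} (p : A → Bool) {L x} → allB p L ≡ true → x ∈ L → p x ≡ true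
allB-elim p {y ∷ ys} e x∈ with p y in py
allB-elim p {y ∷ ys} e (here refl) | true = py
allB-elim p {y ∷ ys} e (there x∈)  | true = allB-elim p e x∈

allB-counterexample : ∀ {A : Set} (p : A → Bool) L → allB p L ≡ false → Σ A (λ x → x ∈ L × p x ≡ false)
allB-counterexample p (y ∷ ys) e with p y in py
... | false = y , here refl , py
... | true with allB-counterexample p ys e
...   | z , z∈ , pz = z , there z∈ , pz

countB-pos : ∀ {A : Set} (p : A → Bool) {L x} → x ∈ L → p x ≡ true → 1 ≤ countB p L
countB-pos p {y ∷ ys} (here refl) px rewrite px = s≤s z≤n
countB-pos p {y ∷ ys} (there x∈)  px = ≤-trans (countB-pos p x∈ px) (m≤n+m _ (χ (p y)))

countB-anyB : ∀ {A : Set} (p : A → Bool) L → anyB p L ≡ true → 1 ≤ countB p L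
countB-anyB p L e with anyB-elim p L e
... | x , x∈ , px = countB-pos p x∈ px

countB-¬anyB : ∀ {A : Set} (p : A → Bool) L → anyB p L ≡ false → countB p L ≡ 0
countB-¬anyB p []       e = refl
countB-¬anyB p (x ∷ xs) e with p x
... | false = countB-¬anyB p xs e

countB-mono : ∀ {A : Set} (p q : A → Bool) L → (∀ {x} → x ∈ L → p x ≡ true → q x ≡ true) →
  countB p L ≤ countB q L
countB-mono p q []       h = z≤n
countB-mono p q (x ∷ xs) h with p x in px
... | true rewrite h (here refl) px = s≤s (countB-mono p q xs (λ x∈ → h (there x∈)))
... | false = ≤-trans (countB-mono p q xs (λ x∈ → h (there x∈))) (m≤n+m _ (χ (q x)))

countB≤1-unique : ∀ {A : Set} (p : A → Bool) {L x y} → countB p L ≤ 1 →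
  x ∈ L → y ∈ L → p x ≡ true → p y ≡ true → x ≡ y
countB≤1-unique p c (here refl) (here refl) px py = refl
countB≤1-unique p {z ∷ zs} c (here refl) (there y∈) px py rewrite px =
  ⊥-elim (<-irrefl refl (≤-trans (s≤s (countB-pos p y∈ py)) c))
countB≤1-unique p {z ∷ zs} c (there x∈) (here refl) px py rewrite py =
  ⊥-elim (<-irrefl refl (≤-trans (s≤s (countB-pos p x∈ px)) c))
countB≤1-unique p {z ∷ zs} c (there x∈) (there y∈) px py =
  countB≤1-unique p (≤-trans (m≤n+m _ (χ (p z))) c) x∈ y∈ px py

sumL : {A : Set} → (A → ℕ) → List A → ℕ
sumL f []       = 0
sumL f (x ∷ xs) = f x + sumL f xs

countB-sumL : ∀ {A : Set} (p : A → Bool) L → countB p L ≡ sumL (λ x → χ (p x)) L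
countB-sumL p []       = refl
countB-sumL p (x ∷ xs) = cong (χ (p x) +_) (countB-sumL p xs)

countB-allFin : ∀ {n} (p : Fin n → Bool) → countB p (allFin n) ≡ sum (λ v → χ (p v))
countB-allFin {n} p = go n (λ v → v)
  where
  go : ∀ m (h : Fin m → Fin n) → countB p (tabulate h) ≡ sum (λ v → χ (p (h v)))
  go zero    h = refl
  go (suc m) h = cong (χ (p (h F.zero)) +_) (go m (λ v → h (F.suc v)))

sum-zero : ∀ n {f : Fin n → ℕ} → (∀ v → f v ≡ 0) → sum f ≡ 0
sum-zero n h = trans (sum-cong-≗ h) (sum-replicate-zero n)

sum-ones : ∀ n → sum {n} (λ _ → 1) ≡ n
sum-ones zero    = refl
sum-ones (suc n) = cong suc (sum-ones n)

sum-mono : ∀ n {f g : Fin n → ℕ} → (∀ v → f v ≤ g v) → sum f ≤ sum g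
sum-mono zero    h = z≤n
sum-mono (suc n) h = +-mono-≤ (h F.zero) (sum-mono n (λ v → h (F.suc v)))

sum-strict : ∀ n {f g : Fin n → ℕ} → (∀ v → f v ≤ g v) → (w : Fin n) → f w < g w → sum f < sum g
sum-strict (suc n) h F.zero    lt = +-mono-<-≤ lt (sum-mono n (λ v → h (F.suc v)))
sum-strict (suc n) h (F.suc w) lt = +-mono-≤-< (h F.zero) (sum-strict n (λ v → h (F.suc v)) w lt)

sum-delta : ∀ n (f : Fin n → ℕ) (a : Fin n) → sum (λ v → f v * χ (eqF v a)) ≡ f a
sum-delta (suc n) f F.zero = begin
    f F.zero * 1 + sum (λ v → f (F.suc v) * χ (eqF (F.suc v) F.zero))
  ≡⟨ cong₂ _+_ (*-identityʳ (f F.zero)) (sum-zero n off-diagonal) ⟩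
    f F.zero + 0
  ≡⟨ +-identityʳ (f F.zero) ⟩
    f F.zero ∎
  where
  open ≡-Reasoning
  off-diagonal : ∀ v → f (F.suc v) * χ (eqF (F.suc v) F.zero) ≡ 0
  off-diagonal v rewrite eqF-≢ (F.suc v) F.zero (λ ()) = *-zeroʳ (f (F.suc v))
sum-delta (suc n) f (F.suc a) = cong₂ _+_ at-zero (trans (sum-cong-≗ shift) (sum-delta n (λ v → f (F.suc v)) a))
  where
  at-zero : f F.zero * χ (eqF F.zero (F.suc a)) ≡ 0
  at-zero rewrite eqF-≢ F.zero (F.suc a) (λ ()) = *-zeroʳ (f F.zero)
  shift : ∀ v → f (F.suc v) * χ (eqF (F.suc v) (F.suc a)) ≡ f (F.suc v) * χ (eqF v a)
  shift v = cong (λ b → f (F.suc v) * χ b) (eqF-suc v a)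

sumL-scale : ∀ {A : Set} k (f : A → ℕ) L → k * sumL f L ≡ sumL (λ x → k * f x) L
sumL-scale k f []       = *-zeroʳ k
sumL-scale k f (x ∷ xs) = trans (*-distribˡ-+ k (f x) _) (cong (k * f x +_) (sumL-scale k f xs))

sum-sumL : ∀ {A : Set} n (g : Fin n → A → ℕ) L →
  sum (λ v → sumL (g v) L) ≡ sumL (λ x → sum (λ v → g v x)) L
sum-sumL n g []       = sum-zero n (λ _ → refl)
sum-sumL n g (x ∷ xs) = trans (∑-distrib-+ (λ v → g v x) (λ v → sumL (g v) xs))
  (cong (sum (λ v → g v x) +_) (sum-sumL n g xs))

sumL-cong : ∀ {A : Set} {f g : A → ℕ} L → (∀ {x} → x ∈ L → f x ≡ g x) → sumL f L ≡ sumL g L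
sumL-cong []       h = refl
sumL-cong (x ∷ xs) h = cong₂ _+_ (h (here refl)) (sumL-cong xs (λ x∈ → h (there x∈)))

sumL-const : ∀ {A : Set} c (L : List A) → sumL (λ _ → c) L ≡ length L * c
sumL-const c []       = refl
sumL-const c (x ∷ xs) = cong (c +_) (sumL-const c xs)

sumL≤length : ∀ {A : Set} (f : A → ℕ) L → (∀ x → f x ≤ 1) → sumL f L ≤ length L
sumL≤length f []       h = z≤n
sumL≤length f (x ∷ xs) h = +-mono-≤ (h x) (sumL≤length f xs h)

sumL<length : ∀ {A : Set} (f : A → ℕ) L → (∀ x → f x ≤ 1) → ∀ {y} → y ∈ L → f y ≡ 0 → sumL f L < length L
sumL<length f (x ∷ xs) h (here refl) fy≡0 rewrite fy≡0 = s≤s (sumL≤length f xs h)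
sumL<length f (x ∷ xs) h (there y∈)  fy≡0 = +-mono-≤-< (h x) (sumL<length f xs h y∈ fy≡0)

handshake : ∀ {n} (S : List (Edge n)) → (∀ {e} → e ∈ S → proj₁ e ≢ proj₂ e) → (f : Fin n → ℕ) →
  sum (λ v → f v * countB (incident v) S) ≡ sumL (λ e → f (proj₁ e) + f (proj₂ e)) S
handshake {n} S loopless f = begin
    sum (λ v → f v * countB (incident v) S)
  ≡⟨ sum-cong-≗ (λ v → trans (cong (f v *_) (countB-sumL (incident v) S)) (sumL-scale (f v) _ S)) ⟩
    sum (λ v → sumL (λ e → f v * χ (incident v e)) S)
  ≡⟨ sum-sumL n (λ v e → f v * χ (incident v e)) S ⟩
    sumL (λ e → sum (λ v → f v * χ (incident v e))) S
  ≡⟨ sumL-cong S (λ e∈ → edge-term (loopless e∈)) ⟩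
    sumL (λ e → f (proj₁ e) + f (proj₂ e)) S ∎
  where
  open ≡-Reasoning
  edge-term : ∀ {a b} → a ≢ b → sum (λ v → f v * χ (incident v (a , b))) ≡ f a + f b
  edge-term {a} {b} a≢b = trans (sum-cong-≗ split)
    (trans (∑-distrib-+ (λ v → f v * χ (eqF v a)) (λ v → f v * χ (eqF v b))) (cong₂ _+_ (sum-delta n f a) (sum-delta n f b)))
    where
    split : ∀ v → f v * χ (eqF v a ∨ eqF v b) ≡ f v * χ (eqF v a) + f v * χ (eqF v b)
    split v = trans (cong (f v *_) (χ-∨ (eqF v a) (eqF v b)
                      (λ v≡a → eqF-≢ v b (λ v≡b → a≢b (trans (sym (eqF⇒≡ v a v≡a)) v≡b)))))
                    (*-distribˡ-+ (f v) _ _)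

module Walks {n : ℕ} (S : List (Edge n)) where

  reach-refl : ∀ k u → reach S k u u ≡ true
  reach-refl zero    u = eqF-refl u
  reach-refl (suc k) u = ∨-introˡ _ (reach-refl k u)

  reach-step : ∀ k u w v → reach S k u w ≡ true → adjIn S w v ≡ true → reach S (suc k) u v ≡ true
  reach-step k u w v r a = ∨-introʳ (reach S k u v)
    (anyB-intro (λ w → reach S k u w ∧ adjIn S w v) (∈-allFin w) (∧-intro r a))

  reach-weaken : ∀ m {k u v} → reach S k u v ≡ true → reach S (m + k) u v ≡ true
  reach-weaken zero    r = r
  reach-weaken (suc m) r = ∨-introˡ _ (reach-weaken m r)

  adjacency : Fin n → Fin n → Edge n → Bool
  adjacency u v e = (eqF u (proj₁ e) ∧ eqF v (proj₂ e)) ∨ (eqF u (proj₂ e) ∧ eqF v (proj₁ e))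

  adjIn-forward : ∀ {u v} → (u , v) ∈ S → adjIn S u v ≡ true
  adjIn-forward {u} {v} e∈ = anyB-intro (adjacency u v) e∈ (∨-introˡ _ (∧-intro (eqF-refl u) (eqF-refl v)))

  adjIn-backward : ∀ {u v} → (v , u) ∈ S → adjIn S u v ≡ true
  adjIn-backward {u} {v} e∈ = anyB-intro (adjacency u v) e∈
    (∨-introʳ (eqF u v ∧ eqF v u) (∧-intro (eqF-refl u) (eqF-refl v)))

  adjIn-elim : ∀ u v → adjIn S u v ≡ true → Σ (Edge n) (λ e → e ∈ S × (e ≡ (u , v) ⊎ e ≡ (v , u)))
  adjIn-elim u v h with anyB-elim (adjacency u v) S h
  ... | (a , b) , e∈ , pe with ∨-elim (eqF u a ∧ eqF v b) (eqF u b ∧ eqF v a) pe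
  ...   | inj₁ q = (a , b) , e∈ , inj₁ (cong₂ _,_ (sym (eqF⇒≡ u a (proj₁ (∧-elim _ _ q))))
                                                   (sym (eqF⇒≡ v b (proj₂ (∧-elim _ _ q)))))
  ...   | inj₂ q = (a , b) , e∈ , inj₂ (cong₂ _,_ (sym (eqF⇒≡ v a (proj₂ (∧-elim _ _ q))))
                                                   (sym (eqF⇒≡ u b (proj₁ (∧-elim _ _ q)))))

  incident-endpoint : ∀ {e : Edge n} {x w} → (e ≡ (x , w) ⊎ e ≡ (w , x)) → incident w e ≡ true
  incident-endpoint {x = x} {w} (inj₁ refl) = ∨-introʳ (eqF w x) (eqF-refl w)
  incident-endpoint {x = x} {w} (inj₂ refl) = ∨-introˡ _ (eqF-refl w)

  adjIn⇒covers : ∀ u v → adjIn S u v ≡ true → covers S v ≡ true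
  adjIn⇒covers u v h with adjIn-elim u v h
  ... | e , e∈ , o = anyB-intro (incident v) e∈ (incident-endpoint o)

  reach-mono : ∀ {k j u v} → k ≤ j → reach S k u v ≡ true → reach S j u v ≡ true
  reach-mono {k} {j} {u} {v} k≤j r =
    subst (λ i → reach S i u v ≡ true) (m∸n+n≡m k≤j) (reach-weaken (j ∸ k) r)

  connected-by-edge : ∀ {a b} → (a , b) ∈ S → connected S a b ≡ true
  connected-by-edge {a} {b} e∈ = reach-mono (≤-trans (s≤s z≤n) (toℕ<n a))
    (reach-step 0 a a b (reach-refl 0 a) (adjIn-forward e∈))

  connected-two-step : ∀ {a v b} → 2 ≤ n → adjIn S a v ≡ true → adjIn S v b ≡ true → connected S a b ≡ true
  connected-two-step {a} {v} {b} 2≤n av vb =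
    reach-mono 2≤n (reach-step 1 a v b (reach-step 0 a a v (reach-refl 0 a) av) vb)

  smaller-connected⇒¬rep : ∀ u v → toℕ u < toℕ v → connected S u v ≡ true → isRep S v ≡ false
  smaller-connected⇒¬rep u v u<v c = cong not
    (anyB-intro (λ u → (toℕ u <ᵇ toℕ v) ∧ connected S u v) (∈-allFin u) (∧-intro (T⇒≡true (<⇒<ᵇ u<v)) c))

  uncovered-isolated : ∀ k u v → covers S v ≡ false → reach S k u v ≡ true → u ≡ v
  uncovered-isolated zero    u v _ r = eqF⇒≡ u v r
  uncovered-isolated (suc k) u v uncov r
    with ∨-elim (reach S k u v) (anyB (λ w → reach S k u w ∧ adjIn S w v) (allFin n)) r
  ... | inj₁ r′ = uncovered-isolated k u v uncov r′
  ... | inj₂ q with anyB-elim (λ w → reach S k u w ∧ adjIn S w v) (allFin n) q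
  ...   | w , _ , pw = ⊥-elim (true-false-clash (adjIn⇒covers w v (proj₂ (∧-elim _ _ pw))) uncov)

  uncovered⇒rep : ∀ v → covers S v ≡ false → isRep S v ≡ true
  uncovered⇒rep v uncov = not-intro _ λ h → no-smaller (anyB-elim (λ u → (toℕ u <ᵇ toℕ v) ∧ connected S u v) (allFin n) h)
    where
    no-smaller : Σ (Fin n) (λ u → u ∈ allFin n × ((toℕ u <ᵇ toℕ v) ∧ connected S u v) ≡ true) → ⊥
    no-smaller (u , _ , pu) with ∧-elim _ _ pu
    ... | u<v , c = <-irrefl (cong toℕ (uncovered-isolated n u v uncov c)) (<ᵇ⇒< _ _ (≡true⇒T u<v))

Oriented : ∀ {n} → Edge n → Set
Oriented e = toℕ (proj₁ e) < toℕ (proj₂ e)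

edges-oriented : ∀ {n} (G : Graph n) → All Oriented (edges G)
edges-oriented {n} G = concatMap⁺ {L = allFin n} (λ i → concatMap⁺ {L = allFin n} (candidate i))
  where
  concatMap⁺ : ∀ {A : Set} {f : A → List (Edge n)} {L} → (∀ x → All Oriented (f x)) → All Oriented (concatMap f L)
  concatMap⁺ {L = []}     h = []
  concatMap⁺ {L = x ∷ xs} h = AllP.++⁺ (h x) (concatMap⁺ {L = xs} h)
  candidate : ∀ i j → All Oriented (if (toℕ i <ᵇ toℕ j) ∧ adj G i j then (i , j) ∷ [] else [])
  candidate i j with toℕ i <ᵇ toℕ j in i<ᵇj
  ... | false = []
  ... | true with adj G i j
  ...   | true  = <ᵇ⇒< _ _ (≡true⇒T i<ᵇj) ∷ []
  ...   | false = []

subsets-All : ∀ {A : Set} {P : A → Set} {L} → All P L → All (All P) (subsets L)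
subsets-All []       = [] ∷ []
subsets-All (p ∷ ps) = AllP.++⁺ (subsets-All ps) (AllP.map⁺ (All.map (p ∷_) (subsets-All ps)))

module EdgeSet {n : ℕ} (B : List (Edge n)) (oriented : All Oriented B) where
  open Walks B

  deg : Fin n → ℕ
  deg v = countB (incident v) B

  cov rep : Fin n → Bool
  cov v = covers B v
  rep v = isRep B v

  ρ : Fin n → ℕ
  ρ v = χ (rep v)

  covered-of-deg : ∀ v → 1 ≤ deg v → cov v ≡ true
  covered-of-deg v 1≤deg with cov v in cv
  ... | true  = refl
  ... | false = ⊥-elim (<-irrefl (sym (countB-¬anyB (incident v) B cv)) 1≤deg)

  -- The larger endpoint of an edge is connected to the smaller one.
  larger-endpoint-¬rep : ∀ {a b} → (a , b) ∈ B → rep b ≡ false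
  larger-endpoint-¬rep {a} {b} e∈ = smaller-connected⇒¬rep a b (All.lookup oriented e∈) (connected-by-edge e∈)

  kcov-sum : kcov B ≡ sum (λ v → χ (cov v ∧ rep v))
  kcov-sum = countB-allFin (λ v → cov v ∧ rep v)

  -- A covered representative has degree at least one.
  covered-rep≤ρ·deg : ∀ v → χ (cov v ∧ rep v) ≤ ρ v * deg v
  covered-rep≤ρ·deg v with cov v in cv | rep v
  ... | false | _     = z≤n
  ... | true  | false = z≤n
  ... | true  | true  = subst (1 ≤_) (sym (*-identityˡ (deg v))) (countB-anyB (incident v) B cv)

  -- Handshake with weight ρ: only smaller endpoints contribute.
  ρ·deg-sum : sum (λ v → ρ v * deg v) ≡ sumL (λ e → ρ (proj₁ e)) B
  ρ·deg-sum = trans (handshake B (λ e∈ a≡b → <-irrefl (cong toℕ a≡b) (All.lookup oriented e∈)) ρ)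
    (sumL-cong B (λ { {a , b} e∈ → trans (cong (λ r → ρ a + χ r) (larger-endpoint-¬rep e∈)) (+-identityʳ (ρ a)) }))

  smaller-endpoints≤length : sumL (λ e → ρ (proj₁ e)) B ≤ length B
  smaller-endpoints≤length = sumL≤length _ B (λ e → χ≤1 (rep (proj₁ e)))

  kcov≤ρ·deg-sum : kcov B ≤ sum (λ v → ρ v * deg v)
  kcov≤ρ·deg-sum = ≤-trans (≤-reflexive kcov-sum) (sum-mono n covered-rep≤ρ·deg)

  kcov≤length : kcov B ≤ length B
  kcov≤length = ≤-trans kcov≤ρ·deg-sum (≤-trans (≤-reflexive ρ·deg-sum) smaller-endpoints≤length)

  heavy-rep⇒kcov<length : ∀ v → rep v ≡ true → 2 ≤ deg v → kcov B < length B
  heavy-rep⇒kcov<length v rv 2≤deg = <-≤-trans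
    (≤-<-trans (≤-reflexive kcov-sum) (sum-strict n covered-rep≤ρ·deg v strict-at-v))
    (≤-trans (≤-reflexive ρ·deg-sum) smaller-endpoints≤length)
    where
    strict-at-v : χ (cov v ∧ rep v) < ρ v * deg v
    strict-at-v rewrite covered-of-deg v (≤-trans (s≤s z≤n) 2≤deg) | rv | *-identityˡ (deg v) = 2≤deg

  ¬rep-edge⇒kcov<length : ∀ {e} → e ∈ B → rep (proj₁ e) ≡ false → kcov B < length B
  ¬rep-edge⇒kcov<length e∈ ¬rep = ≤-<-trans kcov≤ρ·deg-sum
    (subst (_< length B) (sym ρ·deg-sum) (sumL<length _ B (λ e → χ≤1 (rep (proj₁ e))) e∈ (cong χ ¬rep)))

  two-vertices : ∀ {e} → e ∈ B → 2 ≤ n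
  two-vertices {x , v} e∈ = ≤-<-trans (≤-trans (s≤s z≤n) (All.lookup oriented e∈)) (toℕ<n v)

  reps-sharing-neighbour : ∀ {x a v} → (x , v) ∈ B → (a , v) ∈ B → rep x ≡ true → rep a ≡ true → x ≡ a
  reps-sharing-neighbour {x} {a} {v} xv∈ av∈ rx ra with <-cmp (toℕ x) (toℕ a)
  ... | tri< x<a _ _ = ⊥-elim (true-false-clash ra
          (smaller-connected⇒¬rep x a x<a (connected-two-step (two-vertices xv∈) (adjIn-forward xv∈) (adjIn-backward av∈))))
  ... | tri> _ _ a<x = ⊥-elim (true-false-clash rx
          (smaller-connected⇒¬rep a x a<x (connected-two-step (two-vertices xv∈) (adjIn-forward av∈) (adjIn-backward xv∈))))
  ... | tri≈ _ x≡a _ = toℕ-injective x≡a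

  -- If all smaller endpoints are representatives, a vertex of degree ≥ 2 that
  -- is not one is the larger endpoint of all its edges, whose smaller
  -- endpoints then coincide: that representative has at least the same degree.
  heavy-vertex⇒heavy-rep : (∀ {e} → e ∈ B → rep (proj₁ e) ≡ true) →
    ∀ v → 2 ≤ deg v → Σ (Fin n) (λ w → rep w ≡ true × 2 ≤ deg w)
  heavy-vertex⇒heavy-rep smaller-rep v 2≤deg with rep v in rv
  ... | true  = v , rv , 2≤deg
  ... | false with anyB-elim (incident v) B (covered-of-deg v (≤-trans (s≤s z≤n) 2≤deg))
  ...   | (a , b) , ab∈ , v∈ab with ∨-elim (eqF v a) (eqF v b) v∈ab
  ...     | inj₁ v≡a rewrite eqF⇒≡ v a v≡a = ⊥-elim (true-false-clash (smaller-rep ab∈) rv)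
  ...     | inj₂ v≡b rewrite eqF⇒≡ v b v≡b =
    a , smaller-rep ab∈ , ≤-trans 2≤deg (countB-mono (incident b) (incident a) B edge-at-b)
    where
    edge-at-b : ∀ {e} → e ∈ B → incident b e ≡ true → incident a e ≡ true
    edge-at-b {x , y} e∈ b∈e with ∨-elim (eqF b x) (eqF b y) b∈e
    ... | inj₁ b≡x rewrite eqF⇒≡ b x b≡x = ⊥-elim (true-false-clash (smaller-rep e∈) rv)
    ... | inj₂ b≡y rewrite eqF⇒≡ b y b≡y
        | reps-sharing-neighbour e∈ ab∈ (smaller-rep e∈) (smaller-rep ab∈) = ∨-introˡ _ (eqF-refl a)

  heavy-vertex⇒kcov<length : ∀ v → 2 ≤ deg v → kcov B < length B
  heavy-vertex⇒kcov<length v 2≤deg with allB (λ e → rep (proj₁ e)) B in all-rep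
  ... | false with allB-counterexample (λ e → rep (proj₁ e)) B all-rep
  ...   | e , e∈ , ¬rep = ¬rep-edge⇒kcov<length e∈ ¬rep
  heavy-vertex⇒kcov<length v 2≤deg | true
    with heavy-vertex⇒heavy-rep (allB-elim (λ e → rep (proj₁ e)) all-rep) v 2≤deg
  ... | w , rw , 2≤deg-w = heavy-rep⇒kcov<length w rw 2≤deg-w

  module Matching (deg≤1 : ∀ v → deg v ≤ 1) where

    incident-unique : ∀ {w e₁ e₂} → e₁ ∈ B → e₂ ∈ B → incident w e₁ ≡ true → incident w e₂ ≡ true → e₁ ≡ e₂
    incident-unique {w} = countB≤1-unique (incident w) (deg≤1 w)

    reach-short : ∀ k u v → reach B k u v ≡ true → u ≡ v ⊎ adjIn B u v ≡ true
    reach-short zero    u v r = inj₁ (eqF⇒≡ u v r)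
    reach-short (suc k) u v r with ∨-elim (reach B k u v) (anyB (λ w → reach B k u w ∧ adjIn B w v) (allFin n)) r
    ... | inj₁ r′ = reach-short k u v r′
    ... | inj₂ q with anyB-elim (λ w → reach B k u w ∧ adjIn B w v) (allFin n) q
    ...   | w , _ , pw with ∧-elim _ _ pw
    ...     | uw , wv with reach-short k u w uw
    ...       | inj₁ refl = inj₂ wv
    ...       | inj₂ u-w with adjIn-elim u w u-w | adjIn-elim w v wv
    ...         | e₁ , e₁∈ , o₁ | e₂ , e₂∈ , o₂ =
      inj₁ (back-and-forth o₁ o₂ (incident-unique {w} e₁∈ e₂∈ (incident-endpoint o₁) (incident-endpoint (swap o₂))))
      where
      -- Leaving w along the edge just used returns to the start.
      back-and-forth : ∀ {e₁ e₂ : Edge n} → (e₁ ≡ (u , w) ⊎ e₁ ≡ (w , u)) → (e₂ ≡ (w , v) ⊎ e₂ ≡ (v , w)) → e₁ ≡ e₂ → u ≡ v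
      back-and-forth (inj₁ refl) (inj₁ refl) eq = trans (cong proj₁ eq) (cong proj₂ eq)
      back-and-forth (inj₁ refl) (inj₂ refl) eq = cong proj₁ eq
      back-and-forth (inj₂ refl) (inj₁ refl) eq = cong proj₂ eq
      back-and-forth (inj₂ refl) (inj₂ refl) eq = trans (cong proj₂ eq) (cong proj₁ eq)

    -- The smaller endpoint of an edge is a representative: its component is the edge.
    smaller-endpoint-rep : ∀ {a b} → (a , b) ∈ B → rep a ≡ true
    smaller-endpoint-rep {a} {b} ab∈ =
      not-intro _ (λ h → no-smaller (anyB-elim (λ u → (toℕ u <ᵇ toℕ a) ∧ connected B u a) (allFin n) h))
      where
      no-smaller : Σ (Fin n) (λ u → u ∈ allFin n × ((toℕ u <ᵇ toℕ a) ∧ connected B u a) ≡ true) → ⊥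
      no-smaller (u , _ , pu) with ∧-elim _ _ pu
      ... | u<ᵇa , c with reach-short n u a c
      ...   | inj₁ u≡a = <-irrefl (cong toℕ u≡a) (<ᵇ⇒< _ _ (≡true⇒T u<ᵇa))
      ...   | inj₂ u-a with adjIn-elim u a u-a
      ...     | e , e∈ , o with o | incident-unique {a} e∈ ab∈ (incident-endpoint o) (∨-introˡ _ (eqF-refl a))
      ...       | inj₁ refl | eq = <-irrefl (cong (λ z → toℕ (proj₁ z)) eq) (<ᵇ⇒< _ _ (≡true⇒T u<ᵇa))
      ...       | inj₂ refl | eq = <-asym (All.lookup oriented ab∈)
                                     (subst (λ z → toℕ z < toℕ a) (cong proj₂ eq) (<ᵇ⇒< _ _ (≡true⇒T u<ᵇa)))

    covered⇒deg1 : ∀ v → cov v ≡ true → deg v ≡ 1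
    covered⇒deg1 v cv = ≤-antisym (deg≤1 v) (countB-anyB (incident v) B cv)

    deg≡χcov : ∀ v → deg v ≡ χ (cov v)
    deg≡χcov v with cov v in cv
    ... | false = countB-¬anyB (incident v) B cv
    ... | true  = covered⇒deg1 v cv

    kcov≡length : kcov B ≡ length B
    kcov≡length = begin
        kcov B                          ≡⟨ kcov-sum ⟩
        sum (λ v → χ (cov v ∧ rep v))   ≡⟨ sum-cong-≗ covered-rep≡ρ·deg ⟩
        sum (λ v → ρ v * deg v)         ≡⟨ ρ·deg-sum ⟩
        sumL (λ e → ρ (proj₁ e)) B      ≡⟨ sumL-cong B (λ { {a , b} ab∈ → cong χ (smaller-endpoint-rep ab∈) }) ⟩
        sumL (λ _ → 1) B                ≡⟨ trans (sumL-const 1 B) (*-identityʳ _) ⟩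
        length B                        ∎
      where
      open ≡-Reasoning
      covered-rep≡ρ·deg : ∀ v → χ (cov v ∧ rep v) ≡ ρ v * deg v
      covered-rep≡ρ·deg v rewrite deg≡χcov v with cov v
      ... | false = sym (*-zeroʳ (ρ v))
      ... | true  = sym (*-identityʳ (ρ v))

    covered uncovered : ℕ
    covered   = countB cov (allFin n)
    uncovered = countB (λ v → not (cov v)) (allFin n)

    -- A matching covers exactly 2|B| vertices (handshake with weight 1).
    covered≡2·length : covered ≡ length B * 2
    covered≡2·length = trans (countB-allFin cov)
      (trans (sum-cong-≗ (λ v → trans (sym (deg≡χcov v)) (sym (*-identityˡ (deg v)))))
      (trans (handshake B (λ e∈ a≡b → <-irrefl (cong toℕ a≡b) (All.lookup oriented e∈)) (λ _ → 1))
             (sumL-const 2 B)))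

    covered+uncovered : covered + uncovered ≡ n
    covered+uncovered = trans (cong₂ _+_ (countB-allFin cov) (countB-allFin (λ v → not (cov v))))
      (trans (sym (∑-distrib-+ (λ v → χ (cov v)) (λ v → χ (not (cov v)))))
             (trans (sum-cong-≗ one) (sum-ones n)))
      where
      one : ∀ v → χ (cov v) + χ (not (cov v)) ≡ 1
      one v with cov v
      ... | true  = refl
      ... | false = refl

    kcomp≡kcov+uncovered : kcomp B ≡ kcov B + uncovered
    kcomp≡kcov+uncovered = trans (countB-allFin rep) (trans (sum-cong-≗ split)
      (trans (∑-distrib-+ (λ v → χ (cov v ∧ rep v)) (λ v → χ (not (cov v))))
             (sym (cong₂ _+_ kcov-sum (countB-allFin (λ v → not (cov v)))))))
      where
      split : ∀ v → ρ v ≡ χ (cov v ∧ rep v) + χ (not (cov v))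
      split v with cov v in cv
      ... | true  = sym (+-identityʳ _)
      ... | false rewrite uncovered⇒rep v cv = refl

    kcomp∸kcov : kcomp B ∸ kcov B ≡ n ∸ 2 * length B
    kcomp∸kcov = begin
        kcomp B ∸ kcov B                 ≡⟨ cong (_∸ kcov B) kcomp≡kcov+uncovered ⟩
        kcov B + uncovered ∸ kcov B      ≡⟨ m+n∸m≡n (kcov B) uncovered ⟩
        uncovered                        ≡⟨ sym (m+n∸m≡n covered uncovered) ⟩
        covered + uncovered ∸ covered    ≡⟨ cong₂ _∸_ covered+uncovered (trans covered≡2·length (*-comm (length B) 2)) ⟩
        n ∸ 2 * length B                 ∎
      where open ≡-Reasoning

    length≤n : length B < suc n
    length≤n = s≤s (≤-trans (m≤m*n (length B) 2)
      (≤-trans (≤-reflexive (sym covered≡2·length)) (≤-trans (m≤m+n covered uncovered) (≤-reflexive covered+uncovered))))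

module _ {n : ℕ} (B : List (Edge n)) where
  isMatching⇒deg≤1 : isMatching B ≡ true → ∀ v → countB (incident v) B ≤ 1
  isMatching⇒deg≤1 h v = ≤ᵇ⇒≤ _ _ (≡true⇒T (allB-elim (λ v → countB (incident v) B ≤ᵇ 1) h (∈-allFin v)))

  ¬isMatching⇒heavy-vertex : isMatching B ≡ false → Σ (Fin n) (λ v → 2 ≤ countB (incident v) B)
  ¬isMatching⇒heavy-vertex h with allB-counterexample (λ v → countB (incident v) B ≤ᵇ 1) (allFin n) h
  ... | v , _ , ¬≤1 with countB (incident v) B ≤? 1
  ...   | yes ≤1  = ⊥-elim (true-false-clash (T⇒≡true (≤⇒≤ᵇ ≤1)) ¬≤1)
  ...   | no  ≰1  = v , ≰⇒> ≰1

∸-positive : ∀ m k → k < m → Σ ℕ (λ j → m ∸ k ≡ suc j)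
∸-positive (suc m) zero    _         = m , refl
∸-positive (suc m) (suc k) (s≤s k<m) = ∸-positive m k k<m

map-applyUpTo : ∀ {a b} {A : Set a} {B : Set b} (g : A → B) (f : ℕ → A) N →
  map g (applyUpTo f N) ≡ applyUpTo (λ i → g (f i)) N
map-applyUpTo g f zero    = refl
map-applyUpTo g f (suc N) = cong (g (f 0) ∷_) (map-applyUpTo g (λ i → f (suc i)) N)

module RingSums {c ℓ} (𝓡 : CommutativeRing c ℓ) where
  open CommutativeRing 𝓡 using (Carrier; _≈_; 0#; 1#) renaming (_+_ to _⊕_; _*_ to _⊗_)
  module R = CommutativeRing 𝓡
  open Poly 𝓡
  open import Algebra.Properties.CommutativeSemigroup R.+-commutativeSemigroup using (interchange)
  open import Relation.Binary.Reasoning.Setoid R.setoid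

  sumR-++ : ∀ xs ys → sumR (xs ++ ys) ≈ sumR xs ⊕ sumR ys
  sumR-++ []       ys = R.sym (R.+-identityˡ _)
  sumR-++ (x ∷ xs) ys = R.trans (R.+-congˡ (sumR-++ xs ys)) (R.sym (R.+-assoc _ _ _))

  sumR-concatMap : ∀ {A : Set} (f : A → List Carrier) L → sumR (concatMap f L) ≈ sumR (map (λ a → sumR (f a)) L)
  sumR-concatMap f []       = R.refl
  sumR-concatMap f (a ∷ as) = R.trans (sumR-++ (f a) (concatMap f as)) (R.+-congˡ (sumR-concatMap f as))

  sumR-cong : ∀ {A : Set} {f g : A → Carrier} L → (∀ {x} → x ∈ L → f x ≈ g x) → sumR (map f L) ≈ sumR (map g L)
  sumR-cong []       h = R.refl
  sumR-cong (x ∷ xs) h = R.+-cong (h (here refl)) (sumR-cong xs (λ x∈ → h (there x∈)))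

  sumR-zero : ∀ {A : Set} {f : A → Carrier} L → (∀ {x} → x ∈ L → f x ≈ 0#) → sumR (map f L) ≈ 0#
  sumR-zero []       h = R.refl
  sumR-zero (x ∷ xs) h = R.trans (R.+-cong (h (here refl)) (sumR-zero xs (λ x∈ → h (there x∈)))) (R.+-identityˡ 0#)

  sum-subsets-collapse : ∀ {A : Set} (φ : List A → Carrier) → (∀ a as → φ (a ∷ as) ≈ 0#) →
    ∀ L → sumR (map φ (subsets L)) ≈ φ []
  sum-subsets-collapse φ vanish []       = R.+-identityʳ _
  sum-subsets-collapse φ vanish (a ∷ as) = begin
      sumR (map φ (subsets as ++ map (a ∷_) (subsets as)))
    ≡⟨ cong sumR (ListP.map-++ φ (subsets as) _) ⟩
      sumR (map φ (subsets as) ++ map φ (map (a ∷_) (subsets as)))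
    ≈⟨ sumR-++ (map φ (subsets as)) (map φ (map (a ∷_) (subsets as))) ⟩
      sumR (map φ (subsets as)) ⊕ sumR (map φ (map (a ∷_) (subsets as)))
    ≡⟨ cong (λ z → sumR (map φ (subsets as)) ⊕ sumR z) (sym (ListP.map-∘ (subsets as))) ⟩
      sumR (map φ (subsets as)) ⊕ sumR (map (λ s → φ (a ∷ s)) (subsets as))
    ≈⟨ R.+-cong (sum-subsets-collapse φ vanish as) (sumR-zero (subsets as) (λ {s} _ → vanish a s)) ⟩
      φ [] ⊕ 0#
    ≈⟨ R.+-identityʳ _ ⟩
      φ []
    ∎

  range-zero : ∀ {ψ : ℕ → Carrier} N → (∀ i → ψ i ≈ 0#) → sumR (applyUpTo ψ N) ≈ 0#
  range-zero zero    h = R.refl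
  range-zero (suc N) h = R.trans (R.+-cong (h 0) (range-zero N (λ i → h (suc i)))) (R.+-identityˡ 0#)

  range-cong : ∀ {f g : ℕ → Carrier} N → (∀ i → f i ≈ g i) → sumR (applyUpTo f N) ≈ sumR (applyUpTo g N)
  range-cong zero    h = R.refl
  range-cong (suc N) h = R.+-cong (h 0) (range-cong N (λ i → h (suc i)))

  range-+ : ∀ (f g : ℕ → Carrier) N →
    sumR (applyUpTo (λ i → f i ⊕ g i) N) ≈ sumR (applyUpTo f N) ⊕ sumR (applyUpTo g N)
  range-+ f g zero    = R.sym (R.+-identityˡ 0#)
  range-+ f g (suc N) = R.trans (R.+-congˡ (range-+ (λ i → f (suc i)) (λ i → g (suc i)) N)) (interchange _ _ _ _)

  range-single : ∀ N (ψ : ℕ → Carrier) k → k < N → (∀ i → i ≢ k → ψ i ≈ 0#) → sumR (applyUpTo ψ N) ≈ ψ k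
  range-single (suc N) ψ zero    _         h =
    R.trans (R.+-congˡ (range-zero N (λ i → h (suc i) (λ ())))) (R.+-identityʳ _)
  range-single (suc N) ψ (suc k) (s≤s k<N) h =
    R.trans (R.+-cong (h 0 (λ ())) (range-single N (λ i → ψ (suc i)) k k<N (λ i i≢k → h (suc i) (λ e → i≢k (suc-injective e)))))
            (R.+-identityˡ _)

  ι-+ : ∀ m k → ι (m + k) ≈ ι m ⊕ ι k
  ι-+ zero    k = R.sym (R.+-identityˡ _)
  ι-+ (suc m) k = R.trans (R.+-congˡ (ι-+ m k)) (R.sym (R.+-assoc _ _ _))

  pow-1# : ∀ k → pow 1# k ≈ 1#
  pow-1# zero    = R.refl
  pow-1# (suc k) = R.trans (R.*-congˡ (pow-1# k)) (R.*-identityˡ 1#)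

  single-by-size : ∀ {E : Set} (m : List E → Bool) (H : ℕ → Carrier) N (B : List E) →
    (m B ≡ true → length B < N) →
    sumR (applyUpTo (λ i → ι (χ (m B ∧ (length B ≡ᵇ i))) ⊗ H i) N) ≈ (if m B then H (length B) else 0#)
  single-by-size m H N B bound with m B in mB
  ... | false = range-zero N (λ i → R.zeroˡ (H i))
  ... | true  = R.trans (range-single N _ (length B) (bound refl) off-size) at-size
    where
    off-size : ∀ i → i ≢ length B → ι (χ (length B ≡ᵇ i)) ⊗ H i ≈ 0#
    off-size i i≢|B| with length B ≡ᵇ i in same
    ... | true  = ⊥-elim (i≢|B| (sym (≡ᵇ⇒≡ _ _ (≡true⇒T same))))
    ... | false = R.zeroˡ (H i)
    at-size : ι (χ (length B ≡ᵇ length B)) ⊗ H (length B) ≈ H (length B)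
    at-size rewrite T⇒≡true (≡⇒≡ᵇ (length B) (length B) refl) =
      R.trans (R.*-congʳ (R.+-identityʳ 1#)) (R.*-identityˡ _)

  sum-by-size : ∀ {E : Set} (m : List E → Bool) (H : ℕ → Carrier) N L →
    (∀ {B} → B ∈ L → m B ≡ true → length B < N) →
    sumR (map (λ B → if m B then H (length B) else 0#) L) ≈
    sumR (applyUpTo (λ i → ι (countB (λ S → m S ∧ (length S ≡ᵇ i)) L) ⊗ H i) N)
  sum-by-size m H N []      _     = R.sym (range-zero N (λ i → R.zeroˡ (H i)))
  sum-by-size m H N (B ∷ L) bound = R.sym (begin
      sumR (applyUpTo (λ i → ι (χ (sized B i) + count L i) ⊗ H i) N)
    ≈⟨ range-cong N (λ i → R.trans (R.*-congʳ (ι-+ (χ (sized B i)) (count L i))) (R.distribʳ _ _ _)) ⟩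
      sumR (applyUpTo (λ i → ι (χ (sized B i)) ⊗ H i ⊕ ι (count L i) ⊗ H i) N)
    ≈⟨ range-+ (λ i → ι (χ (sized B i)) ⊗ H i) (λ i → ι (count L i) ⊗ H i) N ⟩
      sumR (applyUpTo (λ i → ι (χ (sized B i)) ⊗ H i) N) ⊕ sumR (applyUpTo (λ i → ι (count L i) ⊗ H i) N)
    ≈⟨ R.+-cong (single-by-size m H N B (bound (here refl)))
                (R.sym (sum-by-size m H N L (λ B∈ → bound (there B∈)))) ⟩
      (if m B then H (length B) else 0#) ⊕ sumR (map (λ B → if m B then H (length B) else 0#) L)
    ∎)
    where
    sized : List _ → ℕ → Bool
    sized S i = m S ∧ (length S ≡ᵇ i)
    count : List (List _) → ℕ → ℕ
    count L i = countB (λ S → sized S i) L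

module Specialisation {c ℓ} (𝓡 : CommutativeRing c ℓ) {n : ℕ} (G : Graph n) where
  open CommutativeRing 𝓡 using (Carrier; _≈_; 0#; 1#; -_) renaming (_+_ to _⊕_; _*_ to _⊗_)
  module R = CommutativeRing 𝓡
  open Poly 𝓡
  open RingSums 𝓡 hiding (module R)
  open import Relation.Binary.Reasoning.Setoid R.setoid

  edge-subsets : List (List (Edge n))
  edge-subsets = subsets (edges G)

  oriented-subsets : ∀ {B} → B ∈ edge-subsets → All Oriented B
  oriented-subsets B∈ = All.lookup (subsets-All (edges-oriented G)) B∈

  term : Carrier → Carrier → List (Edge n) → List (Edge n) → Carrier
  term x z A B = if disjointV A B
    then pow x (kcomp (A ++ B) ∸ kcov B) ⊗ pow 0# (length A + length B ∸ kcov B) ⊗ pow z (kcov B)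
    else 0#

  weight : Carrier → Carrier → ℕ → Carrier
  weight x y i = pow x (n ∸ 2 * i) ⊗ pow y i

  -- A positive power of 0 kills the term.
  term-vanishes : ∀ x z A B j → length A + length B ∸ kcov B ≡ suc j → term x z A B ≈ 0#
  term-vanishes x z A B j exponent with disjointV A B
  ... | false = R.refl
  ... | true  = begin
      pow x (kcomp (A ++ B) ∸ kcov B) ⊗ pow 0# (length A + length B ∸ kcov B) ⊗ pow z (kcov B)
    ≡⟨ cong (λ k → pow x (kcomp (A ++ B) ∸ kcov B) ⊗ pow 0# k ⊗ pow z (kcov B)) exponent ⟩
      pow x (kcomp (A ++ B) ∸ kcov B) ⊗ (0# ⊗ pow 0# j) ⊗ pow z (kcov B)
    ≈⟨ R.*-congʳ (R.*-congˡ (R.zeroˡ _)) ⟩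
      pow x (kcomp (A ++ B) ∸ kcov B) ⊗ 0# ⊗ pow z (kcov B)
    ≈⟨ R.*-congʳ (R.zeroʳ _) ⟩
      0# ⊗ pow z (kcov B)
    ≈⟨ R.zeroˡ _ ⟩
      0#
    ∎

  -- Since k_cov(B) ≤ |B|, a non-empty A forces a positive power of 0.
  term-nonempty : ∀ x z a as B → All Oriented B → term x z (a ∷ as) B ≈ 0#
  term-nonempty x z a as B oriented =
    let (j , exponent) = ∸-positive (suc (length as + length B)) (kcov B)
                           (s≤s (≤-trans (EdgeSet.kcov≤length B oriented) (m≤n+m (length B) (length as))))
    in term-vanishes x z (a ∷ as) B j exponent

  term-empty : ∀ x y B → All Oriented B → term x y [] B ≈ (if isMatching B then weight x y (length B) else 0#)
  term-empty x y B oriented with isMatching B in matching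
  ... | false =
    let (v , heavy) = ¬isMatching⇒heavy-vertex B matching
        (j , exponent) = ∸-positive (length B) (kcov B) (EdgeSet.heavy-vertex⇒kcov<length B oriented v heavy)
    in term-vanishes x y [] B j exponent
  ... | true  = begin
      term x y [] B
    ≡⟨ if-true (allB-intro (λ v → not (covers [] v ∧ covers B v)) (allFin n) (λ _ → refl)) ⟩
      pow x (kcomp B ∸ kcov B) ⊗ pow 0# (length B ∸ kcov B) ⊗ pow y (kcov B)
    ≡⟨ cong₂ _⊗_ (cong₂ (λ a b → pow x a ⊗ pow 0# b) kcomp∸kcov
                        (trans (cong (length B ∸_) kcov≡length) (n∸n≡0 (length B))))
                 (cong (pow y) kcov≡length) ⟩
      pow x (n ∸ 2 * length B) ⊗ 1# ⊗ pow y (length B)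
    ≈⟨ R.*-congʳ (R.*-identityʳ _) ⟩
      weight x y (length B)
    ∎
    where open EdgeSet.Matching B oriented (isMatching⇒deg≤1 B matching)

  matching-sum : Carrier → Carrier → Carrier
  matching-sum x y = sumR (map (λ B → if isMatching B then weight x y (length B) else 0#) edge-subsets)

  ξ≈matching-sum : ∀ x y → ξ G x 0# y ≈ matching-sum x y
  ξ≈matching-sum x y = begin
      ξ G x 0# y
    ≈⟨ sumR-concatMap (λ A → map (term x y A) edge-subsets) edge-subsets ⟩
      sumR (map (λ A → sumR (map (term x y A) edge-subsets)) edge-subsets)
    ≈⟨ sum-subsets-collapse (λ A → sumR (map (term x y A) edge-subsets))
         (λ a as → sumR-zero edge-subsets (λ B∈ → term-nonempty x y a as _ (oriented-subsets B∈))) (edges G) ⟩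
      sumR (map (term x y []) edge-subsets)
    ≈⟨ sumR-cong edge-subsets (λ B∈ → term-empty x y _ (oriented-subsets B∈)) ⟩
      matching-sum x y
    ∎

  -- Grouping matchings by size: a matching has at most n/2 ≤ n edges.
  M≈matching-sum : ∀ x y → M G x y ≈ matching-sum x y
  M≈matching-sum x y = begin
      M G x y
    ≡⟨ cong sumR (map-applyUpTo (λ i → ι (matchCount G i) ⊗ pow x (n ∸ 2 * i) ⊗ pow y i) (λ i → i) (suc n)) ⟩
      sumR (applyUpTo (λ i → ι (matchCount G i) ⊗ pow x (n ∸ 2 * i) ⊗ pow y i) (suc n))
    ≈⟨ range-cong (suc n) (λ i → R.*-assoc (ι (matchCount G i)) (pow x (n ∸ 2 * i)) (pow y i)) ⟩
      sumR (applyUpTo (λ i → ι (matchCount G i) ⊗ weight x y i) (suc n))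
    ≈⟨ R.sym (sum-by-size isMatching (weight x y) (suc n) edge-subsets
         (λ {B} B∈ matching → EdgeSet.Matching.length≤n B (oriented-subsets B∈) (isMatching⇒deg≤1 B matching))) ⟩
      matching-sum x y
    ∎

  M≈ξ : ∀ x y → M G x y ≈ ξ G x 0# y
  M≈ξ x y = R.trans (M≈matching-sum x y) (R.sym (ξ≈matching-sum x y))

  g≈M : ∀ x → g G x ≈ M G 1# x
  g≈M x = sumR-cong (upTo (suc n)) (λ {i} _ →
    R.*-congʳ (R.sym (R.trans (R.*-congˡ (pow-1# (n ∸ 2 * i))) (R.*-identityʳ _))))

  μ≈M : ∀ x → μ G x ≈ M G x (- 1#)
  μ≈M x = sumR-cong (upTo (suc n)) (λ _ → R.trans (R.*-assoc _ _ _) (R.*-comm _ _))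

proposition5 : ∀ {c ℓ} (R : CommutativeRing c ℓ) (n : ℕ) (G : Graph n) →
    let open CommutativeRing R in
    (∀ x y → Poly.M R G x y ≈ Poly.ξ R G x 0# y)
    × (∀ x → Poly.g R G x ≈ Poly.ξ R G 1# 0# x)
    × (∀ x → Poly.μ R G x ≈ Poly.ξ R G x 0# (- 1#))
proposition5 R n G =
  M≈ξ ,
  (λ x → ≈-trans (g≈M x) (M≈ξ 1# x)) ,
  (λ x → ≈-trans (μ≈M x) (M≈ξ x (- 1#)))
  where
  open CommutativeRing R using (1#; -_) renaming (trans to ≈-trans)
  open Specialisation R G
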